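{- Let $n>1$ be an odd integer and let $\varphi$ denote the Euler totient function. Set $d=\gcd(n-1,\varphi(n))$ and $m=2^{v_2(4\varphi(n))-2v_2(d)}d^{2}$. If $\operatorname{cosocle}(m)>\operatorname{rad}(n)$, then $(1,n^{\varphi(n)k}-1,n^{\varphi(n)k})$ is an $abc$ triple for each positive integer $k$.
   Context: For a positive integer $n$, $\operatorname{rad}(n)$ denotes the product of the distinct prime factors of $n$ (with $\operatorname{rad}(1)=1$), and $\operatorname{cosocle}(n)=\frac{n}{\operatorname{rad}(n)}$. $v_2$ is the $2$-adic valuation. An $abc$ triple is a triple $(a,b,c)$ of relatively prime positive integers with $a+b=c$ and $\operatorname{rad}(abc)<c$. -}

module Defs where

open import Data.Nat using (ℕ; zero; suc; pred; _+_; _*_; _∸_; _^_; _<_; _>_; _≤_)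
open import Data.Nat.DivMod using (_/_; _%_)
open import Data.Nat.Divisibility using (_∣_; _∣?_)
open import Data.Nat.GCD using (gcd)
open import Data.Nat.Coprimality using (Coprime)
open import Data.Nat.Primality using (Prime; prime?)
open import Data.List using (List; upTo; filter; length)
open import Data.Nat.ListAction using (product)
open import Data.Product using (_×_)
open import Relation.Binary.PropositionalEquality using (_≡_)
open import Relation.Nullary.Decidable using (_×-dec_)

-- Euler's totient: number of k with 1 ≤ k ≤ n and gcd(k, n) = 1
-- (φ(0) = 0; only used for n > 1).
φ : ℕ → ℕ
φ n = length (filter (λ k → Data.Nat.Coprimality.coprime? (suc k) n) (upTo n))

rad : ℕ → ℕ
rad n = product (filter (λ p → prime? p ×-dec (p ∣? n)) (upTo (suc n)))

-- cosocle(n) = n / rad(n).  Since rad n ≥ 1 always, suc (pred (rad n)) = rad n;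
-- the suc∘pred only serves to make the divisor syntactically nonzero.
cosocle : ℕ → ℕ
cosocle n = n / suc (pred (rad n))

-- 2-adic valuation with fuel; v₂ 0 = 0 by convention (never used at 0).
v₂-aux : ℕ → ℕ → ℕ
v₂-aux zero    n = 0
v₂-aux (suc f) zero = 0
v₂-aux (suc f) n@(suc _) with n % 2
... | zero  = suc (v₂-aux f (n / 2))
... | suc _ = 0

v₂ : ℕ → ℕ
v₂ n = v₂-aux n n

IsAbcTriple : ℕ → ℕ → ℕ → Set
IsAbcTriple a b c =
  (0 < a × 0 < b × 0 < c) ×
  (Coprime a b × Coprime a c × Coprime b c) ×
  (a + b ≡ c) ×
  (rad (a * b * c) < c)

-- 2^{e} as a syntactically nonzero divisor helper: x / 2^e.
-- (2 ^ e = suc (pred (2 ^ e)) since 2 ^ e ≥ 1.)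
div2^ : ℕ → ℕ → ℕ
div2^ x e = x / suc (pred (2 ^ e))

-- φ(n) = 2c is even, since x ↦ n − x pairs off the residues coprime to n, and
-- d = gcd(n − 1, φ(n)) = 2^a·o with o odd; the m of the statement is then 2^(3 + v₂ c)·o².
-- Let N = n^(φ(n)k). Squaring 1 + 2^(s+3)q gives 1 + 2^(s+4)q′, so an odd number raised
-- to 2·2^s is 1 modulo 2^(s+3), whence 2^(3 + v₂ c) ∣ N − 1. Since d ∣ n − 1 and d ∣ φ(n)k,
-- the binomial theorem gives d² ∣ N − 1, hence o² ∣ N − 1. So N − 1 = m t, and as every
-- prime factor of N divides n,
--   rad(N(N − 1)) ≤ rad(n)·rad(m)·t ≤ cosocle(m)·rad(m)·t ≤ m t < N.

module Submission where

open import Defs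
open import Data.Nat
  using (ℕ; zero; suc; pred; _+_; _*_; _∸_; _^_; _<_; _>_; _≤_; z≤n; s≤s; NonZero; >-nonZero; >-nonZero⁻¹; nonTrivial⇒≢1)
open import Data.Nat.Properties
open import Data.Nat.Divisibility
open import Data.Nat.Coprimality as Coprime using (Coprime; coprime-divisor; 1-coprimeTo)
open import Data.Nat.Primality
  using (Prime; prime?; prime[2]; prime⇒irreducible; prime⇒nonTrivial; euclidsLemma; productOfPrimes≥1)
open import Data.List using (_∷_; []; filter; length; applyUpTo)
open import Data.List.Properties using (filter-accept; filter-reject)
open import Data.Nat.GCD using (gcd; gcd[m,n]∣m; gcd[m,n]∣n; gcd[m,n]≢0)
open import Data.Product using (∃; ∃₂; _×_; _,_; proj₁)
open import Data.Sum using (_⊎_; inj₁; inj₂)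
open import Data.Nat.DivMod using (_%_; _/_; [m+kn]%n≡m%n; m*n%n≡0; m*n/n≡m; m/n*n≤m)
open import Data.Nat.Induction using (<-rec)
open import Function using (_∘_; id)
open import Relation.Nullary using (¬_; contradiction; does; yes; no)
open import Relation.Unary using (Decidable)
open import Data.Bool using (true; false)
open import Relation.Binary.PropositionalEquality
open import Data.Nat.Tactic.RingSolver using (solve; solve-∀)
open ≡-Reasoning

Odd : ℕ → Set
Odd o = ∃ λ t → o ≡ 1 + 2 * t

even-or-odd : ∀ x → (∃ λ q → x ≡ 2 * q) ⊎ Odd x
even-or-odd zero = inj₁ (0 , refl)
even-or-odd (suc x) with even-or-odd x
... | inj₁ (q , refl) = inj₂ (q , refl)
... | inj₂ (q , refl) = inj₁ (suc q , cong suc (sym (+-suc q (q + 0))))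

2^*odd-decomposition : ∀ x → 0 < x → ∃₂ λ a o → Odd o × x ≡ 2 ^ a * o
2^*odd-decomposition = <-rec _ decompose
  where
  decompose : ∀ x → (∀ {y} → y < x → 0 < y → ∃₂ λ a o → Odd o × y ≡ 2 ^ a * o) →
              0 < x → ∃₂ λ a o → Odd o × x ≡ 2 ^ a * o
  decompose x rec 0<x with even-or-odd x
  ... | inj₂ odd = 0 , x , odd , sym (*-identityˡ x)
  ... | inj₁ (zero , refl) = contradiction 0<x (<-irrefl refl)
  ... | inj₁ (suc q , refl) with rec (m<m+n (suc q) (s≤s z≤n)) (s≤s z≤n)
  ...   | a , o , odd , eq = suc a , o , odd , trans (cong (2 *_) eq) (sym (*-assoc 2 (2 ^ a) o))

odd%2≡1 : ∀ t → (1 + 2 * t) % 2 ≡ 1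
odd%2≡1 t = trans (cong (λ u → (1 + u) % 2) (*-comm 2 t)) ([m+kn]%n≡m%n 1 t 2)

v₂-aux-odd : ∀ f t → v₂-aux (suc f) (1 + 2 * t) ≡ 0
v₂-aux-odd f t with (1 + 2 * t) % 2 | odd%2≡1 t
... | _ | refl = refl

v₂-aux-double : ∀ f y → 0 < y → v₂-aux (suc f) (2 * y) ≡ suc (v₂-aux f y)
v₂-aux-double f y@(suc _) _ with 2 * y % 2 | trans (cong (_% 2) (*-comm 2 y)) (m*n%n≡0 y 2)
... | _ | refl = cong (suc ∘ v₂-aux f) (trans (cong (_/ 2) (*-comm 2 y)) (m*n/n≡m y 2))

odd>0 : ∀ {o} → Odd o → 0 < o
odd>0 (_ , refl) = s≤s z≤n

n<2^n : ∀ n → n < 2 ^ n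
n<2^n zero = s≤s z≤n
n<2^n (suc n) = ≤-<-trans (n<2^n n) (m<m+n (2 ^ n) (≤-trans (m^n>0 2 n) (m≤m+n (2 ^ n) 0)))

2^*odd>0 : ∀ a {o} → Odd o → 0 < 2 ^ a * o
2^*odd>0 a odd = *-mono-≤ (m^n>0 2 a) (odd>0 odd)

v₂-aux-2^*odd : ∀ f a {o} → Odd o → a < f → v₂-aux f (2 ^ a * o) ≡ a
v₂-aux-2^*odd (suc f) zero {o} (t , refl) _ =
  subst (λ x → v₂-aux (suc f) x ≡ 0) (sym (*-identityˡ o)) (v₂-aux-odd f t)
v₂-aux-2^*odd (suc f) (suc a) {o} odd (s≤s a<f) = begin
  v₂-aux (suc f) (2 ^ suc a * o)   ≡⟨ cong (v₂-aux (suc f)) (*-assoc 2 (2 ^ a) o) ⟩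
  v₂-aux (suc f) (2 * (2 ^ a * o)) ≡⟨ v₂-aux-double f (2 ^ a * o) (2^*odd>0 a odd) ⟩
  suc (v₂-aux f (2 ^ a * o))       ≡⟨ cong suc (v₂-aux-2^*odd f a odd a<f) ⟩
  suc a                            ∎

v₂-2^*odd : ∀ a {o} → Odd o → v₂ (2 ^ a * o) ≡ a
v₂-2^*odd a {o} odd = v₂-aux-2^*odd (2 ^ a * o) a odd
  (<-≤-trans (n<2^n a) (m≤m*n (2 ^ a) o {{>-nonZero (odd>0 odd)}}))

v₂-decomposition : ∀ {x} → 0 < x → ∃ λ o → Odd o × x ≡ 2 ^ v₂ x * o
v₂-decomposition {x} 0<x with 2^*odd-decomposition x 0<x
... | a , o , odd , refl = o , odd , cong (λ e → 2 ^ e * o) (sym (v₂-2^*odd a odd))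

v₂-2^* : ∀ a {x} → 0 < x → v₂ (2 ^ a * x) ≡ a + v₂ x
v₂-2^* a {x} 0<x with v₂-decomposition 0<x
... | o , odd , x≡ = begin
  v₂ (2 ^ a * x)               ≡⟨ cong (λ y → v₂ (2 ^ a * y)) x≡ ⟩
  v₂ (2 ^ a * (2 ^ v₂ x * o))  ≡⟨ cong v₂ (sym (*-assoc (2 ^ a) _ o)) ⟩
  v₂ (2 ^ a * 2 ^ v₂ x * o)    ≡⟨ cong (λ y → v₂ (y * o)) (sym (^-distribˡ-+-* 2 a (v₂ x))) ⟩
  v₂ (2 ^ (a + v₂ x) * o)      ≡⟨ v₂-2^*odd (a + v₂ x) odd ⟩
  a + v₂ x                     ∎

infix 4 _≡1[mod_]

record _≡1[mod_] (X M : ℕ) : Set where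
  constructor _,_
  field
    quotient : ℕ
    equation : X ≡ 1 + M * quotient

≡1[mod]-^ : ∀ {M X} → X ≡1[mod M ] → ∀ t → X ^ t ≡1[mod M ]
≡1[mod]-^ {M} _ zero = 0 , cong suc (sym (*-zeroʳ M))
≡1[mod]-^ {M} X≡1@(q , refl) (suc t) with ≡1[mod]-^ X≡1 t
... | q′ , eq = q + q′ + M * q * q′ , (begin
  (1 + M * q) * (1 + M * q) ^ t ≡⟨ cong ((1 + M * q) *_) eq ⟩
  (1 + M * q) * (1 + M * q′)    ≡⟨ solve (M ∷ q ∷ q′ ∷ []) ⟩
  1 + M * (q + q′ + M * q * q′) ∎)

≡1[mod]-∣ : ∀ {M M′ X} → M′ ∣ M → X ≡1[mod M ] → X ≡1[mod M′ ]
≡1[mod]-∣ {M′ = M′} (divides c refl) (q , eq) =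
  c * q , trans eq (cong suc (trans (cong (_* q) (*-comm c M′)) (*-assoc M′ c q)))

≡1[mod]-* : ∀ {A B X} → Coprime A B → X ≡1[mod A ] → X ≡1[mod B ] → X ≡1[mod A * B ]
≡1[mod]-* {A} {B} {X} coprime (q₁ , eq₁) (q₂ , eq₂)
  with coprime-divisor coprime (divides q₁ (trans (sym (suc-injective (trans (sym eq₁) eq₂))) (*-comm A q₁)))
... | divides w refl = w , (begin
  X                 ≡⟨ eq₂ ⟩
  1 + B * (w * A)   ≡⟨ solve (A ∷ B ∷ w ∷ []) ⟩
  1 + A * B * w     ∎)

binomial-mod-square : ∀ d a t → ∃ λ q → (1 + d * a) ^ t ≡ 1 + t * d * a + d * d * q
binomial-mod-square d a zero = 0 , cong suc (sym (*-zeroʳ (d * d)))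
binomial-mod-square d a (suc t) with binomial-mod-square d a t
... | q , eq = q + t * a * a + d * a * q , (begin
  (1 + d * a) * (1 + d * a) ^ t                         ≡⟨ cong ((1 + d * a) *_) eq ⟩
  (1 + d * a) * (1 + t * d * a + d * d * q)             ≡⟨ solve (d ∷ a ∷ t ∷ q ∷ []) ⟩
  1 + suc t * d * a + d * d * (q + t * a * a + d * a * q) ∎)

≡1[mod]-^-self : ∀ {d X} → X ≡1[mod d ] → X ^ d ≡1[mod d * d ]
≡1[mod]-^-self {d} (a , refl) with binomial-mod-square d a d
... | q , eq = a + q , trans eq (solve (d ∷ a ∷ q ∷ []))

∣∸1⇒≡1[mod] : ∀ {d x} → 0 < x → d ∣ x ∸ 1 → x ≡1[mod d ]
∣∸1⇒≡1[mod] {d} (s≤s _) (divides a eq) = a , cong suc (trans eq (*-comm a d))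

≡1[mod]-^-multiple : ∀ {d X e} → X ≡1[mod d ] → d ∣ e → X ^ e ≡1[mod d * d ]
≡1[mod]-^-multiple {d} {X} X≡1 (divides b refl) =
  subst (_≡1[mod d * d ]) (trans (^-*-assoc X d b) (cong (X ^_) (*-comm d b)))
    (≡1[mod]-^ (≡1[mod]-^-self X≡1) b)

≡1[mod]-square : ∀ {M X} → X ≡1[mod 2 * M ] → X ^ 2 ≡1[mod 2 * (2 * M) ]
≡1[mod]-square {M} (q , refl) = q + M * q * q , expand M q
  where
  expand : ∀ M q → (1 + 2 * M * q) * ((1 + 2 * M * q) * 1) ≡ 1 + 2 * (2 * M) * (q + M * q * q)
  expand = solve-∀

odd^2≡1[mod8] : ∀ {x} → Odd x → x ^ 2 ≡1[mod 8 ]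
odd^2≡1[mod8] (t , refl) with even-or-odd t
... | inj₁ (u , refl) = u + 2 * u * u , expand₀ u
  where
  expand₀ : ∀ u → (1 + 2 * (2 * u)) * ((1 + 2 * (2 * u)) * 1) ≡ 1 + 8 * (u + 2 * u * u)
  expand₀ = solve-∀
... | inj₂ (u , refl) = 1 + 3 * u + 2 * u * u , expand₁ u
  where
  expand₁ : ∀ u → (1 + 2 * (1 + 2 * u)) * ((1 + 2 * (1 + 2 * u)) * 1) ≡ 1 + 8 * (1 + 3 * u + 2 * u * u)
  expand₁ = solve-∀

odd^[2^[1+s]]≡1[mod2^[3+s]] : ∀ {x} → Odd x → ∀ s → x ^ (2 * 2 ^ s) ≡1[mod 2 ^ (3 + s) ]
odd^[2^[1+s]]≡1[mod2^[3+s]] odd zero = odd^2≡1[mod8] odd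
odd^[2^[1+s]]≡1[mod2^[3+s]] {x} odd (suc s) =
  subst (_≡1[mod 2 ^ (4 + s) ]) (trans (^-*-assoc x (2 * 2 ^ s) 2) (cong (x ^_) (*-comm (2 * 2 ^ s) 2)))
    (≡1[mod]-square {2 ^ (2 + s)} (odd^[2^[1+s]]≡1[mod2^[3+s]] odd s))

odd^[2e]≡1[mod2^[3+v₂e]] : ∀ {x e} → Odd x → 0 < e → x ^ (2 * e) ≡1[mod 2 ^ (3 + v₂ e) ]
odd^[2e]≡1[mod2^[3+v₂e]] {x} {e} odd 0<e with v₂-decomposition 0<e
... | o , _ , e≡ = subst (_≡1[mod 2 ^ (3 + v₂ e) ]) (begin
  (x ^ (2 * 2 ^ v₂ e)) ^ o ≡⟨ ^-*-assoc x (2 * 2 ^ v₂ e) o ⟩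
  x ^ (2 * 2 ^ v₂ e * o)   ≡⟨ cong (x ^_) (trans (*-assoc 2 (2 ^ v₂ e) o) (cong (2 *_) (sym e≡))) ⟩
  x ^ (2 * e)              ∎)
  (≡1[mod]-^ (odd^[2^[1+s]]≡1[mod2^[3+s]] odd (v₂ e)) o)

coprime-*ˡ : ∀ {a b c} → Coprime a c → Coprime b c → Coprime (a * b) c
coprime-*ˡ a⊥c b⊥c (g∣ab , g∣c) =
  b⊥c (coprime-divisor (λ (h∣g , h∣a) → a⊥c (h∣a , ∣-trans h∣g g∣c)) g∣ab , g∣c)

coprime-^ˡ : ∀ {a c} → Coprime a c → ∀ k → Coprime (a ^ k) c
coprime-^ˡ {c = c} _ zero = 1-coprimeTo c
coprime-^ˡ a⊥c (suc k) = coprime-*ˡ a⊥c (coprime-^ˡ a⊥c k)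

∣1+m⇒∣m⇒∣1 : ∀ {d m} → d ∣ 1 + m → d ∣ m → d ∣ 1
∣1+m⇒∣m⇒∣1 {d} {m} d∣1+m = ∣m+n∣m⇒∣n (subst (d ∣_) (+-comm 1 m) d∣1+m)

2-coprime-odd : ∀ {o} → Odd o → Coprime 2 o
2-coprime-odd (t , refl) {g} (g∣2 , g∣o) with prime⇒irreducible prime[2] g∣2
... | inj₁ g≡1 = g≡1
... | inj₂ refl with ∣1⇒≡1 (∣1+m⇒∣m⇒∣1 g∣o (m∣m*n t))
...   | ()

2^-coprime-odd² : ∀ k {o} → Odd o → Coprime (2 ^ k) (o * o)
2^-coprime-odd² k {o} odd = Coprime.sym (coprime-*ˡ o⊥2^k o⊥2^k)
  where
  o⊥2^k : Coprime o (2 ^ k)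
  o⊥2^k = Coprime.sym (coprime-^ˡ (2-coprime-odd odd) k)

prime∤⇒coprime : ∀ {p y} → Prime p → ¬ p ∣ y → Coprime p y
prime∤⇒coprime pp p∤y (g∣p , g∣y) with prime⇒irreducible pp g∣p
... | inj₁ g≡1 = g≡1
... | inj₂ refl = contradiction g∣y p∤y

prime∣^⇒∣ : ∀ {p} x e → Prime p → p ∣ x ^ e → p ∣ x
prime∣^⇒∣ x zero pp p∣1 = contradiction (∣1⇒≡1 p∣1) (nonTrivial⇒≢1 {{prime⇒nonTrivial pp}})
prime∣^⇒∣ x (suc e) pp p∣x^e with euclidsLemma x (x ^ e) pp p∣x^e
... | inj₁ p∣x = p∣x
... | inj₂ p∣x^e′ = prime∣^⇒∣ x e pp p∣x^e′

module Counting {P : ℕ → Set} (P? : Decidable P) where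

  χ : ℕ → ℕ
  χ x = length (filter P? (x ∷ []))

  χ-accept : ∀ {x} → P x → χ x ≡ 1
  χ-accept px = cong length (filter-accept P? px)

  χ-reject : ∀ {x} → ¬ P x → χ x ≡ 0
  χ-reject ¬px = cong length (filter-reject P? ¬px)

  count : ℕ → ℕ → ℕ
  count a zero = 0
  count a (suc i) = χ a + count (suc a) i

  length-filter-∷ : ∀ x xs → length (filter P? (x ∷ xs)) ≡ χ x + length (filter P? xs)
  length-filter-∷ x xs with does (P? x)
  ... | true = refl
  ... | false = refl

  length-filter-applyUpTo : ∀ f a → (∀ x → f x ≡ a + x) →
                            ∀ i → length (filter P? (applyUpTo f i)) ≡ count a i
  length-filter-applyUpTo f a f≗a+ zero = refl
  length-filter-applyUpTo f a f≗a+ (suc i) = begin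
    length (filter P? (f 0 ∷ applyUpTo (f ∘ suc) i))     ≡⟨ length-filter-∷ (f 0) _ ⟩
    χ (f 0) + length (filter P? (applyUpTo (f ∘ suc) i)) ≡⟨ cong₂ _+_ (cong χ f0≡a) rest ⟩
    χ a + count (suc a) i                                 ∎
    where
    f0≡a : f 0 ≡ a
    f0≡a = trans (f≗a+ 0) (+-identityʳ a)
    rest : length (filter P? (applyUpTo (f ∘ suc) i)) ≡ count (suc a) i
    rest = length-filter-applyUpTo (f ∘ suc) (suc a) (λ x → trans (f≗a+ (suc x)) (+-suc a x)) i

  count-+ : ∀ a i j → count a (i + j) ≡ count a i + count (a + i) j
  count-+ a zero j = cong (λ b → count b j) (sym (+-identityʳ a))
  count-+ a (suc i) j = begin
    χ a + count (suc a) (i + j)                     ≡⟨ cong (χ a +_) (count-+ (suc a) i j) ⟩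
    χ a + (count (suc a) i + count (suc a + i) j)   ≡⟨ sym (+-assoc (χ a) _ _) ⟩
    χ a + count (suc a) i + count (suc a + i) j     ≡⟨ cong (λ b → count a (suc i) + count b j) (sym (+-suc a i)) ⟩
    count a (suc i) + count (a + suc i) j           ∎

  count-∷ʳ : ∀ a i → count a (suc i) ≡ count a i + χ (a + i)
  count-∷ʳ a i = begin
    count a (suc i)                  ≡⟨ cong (count a) (+-comm 1 i) ⟩
    count a (i + 1)                  ≡⟨ count-+ a i 1 ⟩
    count a i + (χ (a + i) + 0)      ≡⟨ cong (count a i +_) (+-identityʳ _) ⟩
    count a i + χ (a + i)            ∎

  module _ {s} (reflect : ∀ x y → suc (x + y) ≡ s → P x → P y) where

    χ-reflect : ∀ x y → suc (x + y) ≡ s → χ x ≡ χ y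
    χ-reflect x y x+y+1≡s with P? x | P? y
    ... | yes _  | yes _  = refl
    ... | no _   | no _   = refl
    ... | yes px | no ¬py = contradiction (reflect x y x+y+1≡s px) ¬py
    ... | no ¬px | yes py = contradiction (reflect y x (trans (cong suc (+-comm y x)) x+y+1≡s) py) ¬px

    count-reflect : ∀ i a b → a + i + b ≡ s → count a i ≡ count b i
    count-reflect zero a b _ = refl
    count-reflect (suc i) a b a+i+b≡s = begin
      χ a + count (suc a) i   ≡⟨ cong₂ _+_ (χ-reflect a (b + i) (trans (shift₁ a i b) a+i+b≡s))
                                           (count-reflect i (suc a) b (trans (shift₂ a i b) a+i+b≡s)) ⟩
      χ (b + i) + count b i   ≡⟨ +-comm (χ (b + i)) _ ⟩
      count b i + χ (b + i)   ≡⟨ sym (count-∷ʳ b i) ⟩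
      count b (suc i)         ∎
      where
      shift₁ : ∀ a i b → suc (a + (b + i)) ≡ a + suc i + b
      shift₁ = solve-∀
      shift₂ : ∀ a i b → suc a + i + b ≡ a + suc i + b
      shift₂ = solve-∀

coprime-complement : ∀ {x y n} → x + y ≡ n → Coprime x n → Coprime y n
coprime-complement {x} {y} x+y≡n x⊥n (g∣y , g∣n) =
  x⊥n (∣m+n∣m⇒∣n (subst (_ ∣_) (trans (sym x+y≡n) (+-comm x y)) g∣n) g∣y , g∣n)

φ-odd-even : ∀ {n} → Odd n → 1 < n → ∃ λ c → 0 < c × φ n ≡ 2 * c
φ-odd-even (zero , refl) (s≤s ())
φ-odd-even {n} (j@(suc j′) , refl) 1<n = count 0 j , 0<count , (begin
  φ n                                ≡⟨ length-filter-applyUpTo id 0 (λ _ → refl) n ⟩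
  count 0 n                          ≡⟨ cong (count 0) n≡j+j+1 ⟩
  count 0 (j + j + 1)                ≡⟨ count-+ 0 (j + j) 1 ⟩
  count 0 (j + j) + (χ (j + j) + 0)  ≡⟨ cong₂ _+_ (count-+ 0 j j) (cong (_+ 0) χ[j+j]≡0) ⟩
  count 0 j + count j j + 0          ≡⟨ +-identityʳ _ ⟩
  count 0 j + count j j              ≡⟨ cong (count 0 j +_) (sym (count-reflect reflect j 0 j refl)) ⟩
  count 0 j + count 0 j              ≡⟨ cong (count 0 j +_) (sym (+-identityʳ _)) ⟩
  2 * count 0 j                      ∎)
  where
  open Counting (λ k → Coprime.coprime? (suc k) n)
  n≡j+j+1 : n ≡ j + j + 1
  n≡j+j+1 = trans (+-comm 1 (2 * j)) (cong (λ m → j + m + 1) (+-identityʳ j))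
  reflect : ∀ x y → suc (x + y) ≡ j + j → Coprime (suc x) n → Coprime (suc y) n
  reflect x y eq = coprime-complement (begin
    suc x + suc y     ≡⟨ cong suc (+-suc x y) ⟩
    suc (suc (x + y)) ≡⟨ cong suc eq ⟩
    suc (j + j)       ≡⟨ trans (+-comm 1 (j + j)) (sym n≡j+j+1) ⟩
    n                 ∎)
  χ[j+j]≡0 : χ (j + j) ≡ 0
  χ[j+j]≡0 = χ-reject λ n⊥n →
    >⇒≢ 1<n (n⊥n (subst (n ∣_) (trans n≡j+j+1 (+-comm (j + j) 1)) ∣-refl , ∣-refl))
  0<count : 0 < count 0 j
  0<count = subst (λ c → 0 < c + count 1 j′) (sym (χ-accept (1-coprimeTo n))) (s≤s z≤n)

module Radical where

  open import Data.List using ([]; _∷_; filter; upTo)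
  open import Data.List.Relation.Unary.All as All using (All; []; _∷_)
  open import Data.List.Relation.Unary.All.Properties using (all-filter)
  open import Data.List.Relation.Unary.AllPairs using ([]; _∷_)
  open import Data.List.Relation.Unary.Unique.Propositional using (Unique)
  import Data.List.Relation.Unary.Unique.Propositional.Properties as Unique
  open import Data.List.Membership.Propositional.Properties using (∈-filter⁺; ∈-upTo⁺)
  open import Data.Nat.ListAction using (product)
  open import Data.Nat.ListAction.Properties using (∈⇒∣product)
  open import Data.Nat.Primality.Factorisation using (factorisationHasAllPrimeFactors)
  open import Relation.Nullary.Decidable using (_×-dec_)

  product-of-distinct-primes-∣ : ∀ {ps z} → Unique ps → All Prime ps → All (_∣ z) ps → product ps ∣ z
  product-of-distinct-primes-∣ {[]} _ _ _ = 1∣ _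
  product-of-distinct-primes-∣ {p ∷ ps} {z} (p∉ps ∷ unique) (pp ∷ primes) (p∣z ∷ ps∣z)
    with product-of-distinct-primes-∣ unique primes ps∣z
  ... | divides w z≡w*ps = subst (p * product ps ∣_) (sym z≡w*ps) (*-monoˡ-∣ (product ps) p∣w)
    where
    p⊥ps : Coprime p (product ps)
    p⊥ps = prime∤⇒coprime pp λ p∣ps →
      All.lookup p∉ps (factorisationHasAllPrimeFactors pp p∣ps primes) refl
    p∣w : p ∣ w
    p∣w = coprime-divisor p⊥ps (subst (p ∣_) (trans z≡w*ps (*-comm w (product ps))) p∣z)

  module _ (x : ℕ) where

    private
      prime-factor? : Decidable (λ p → Prime p × p ∣ x)
      prime-factor? p = prime? p ×-dec (p ∣? x)

    rad≥1 : 1 ≤ rad x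
    rad≥1 = productOfPrimes≥1 (All.map proj₁ (all-filter prime-factor? (upTo (suc x))))

    prime∣⇒∣rad : ∀ {p} → Prime p → p ∣ x → .{{NonZero x}} → p ∣ rad x
    prime∣⇒∣rad pp p∣x = ∈⇒∣product (∈-filter⁺ prime-factor? (∈-upTo⁺ (s≤s (∣⇒≤ p∣x))) (pp , p∣x))

    rad≤ : ∀ {z} → .{{NonZero z}} → (∀ p → Prime p → p ∣ x → p ∣ z) → rad x ≤ z
    rad≤ H = ∣⇒≤ (product-of-distinct-primes-∣
      (Unique.filter⁺ prime-factor? (Unique.upTo⁺ (suc x)))
      (All.map proj₁ (all-filter prime-factor? (upTo (suc x))))
      (All.map (λ (pp , p∣x) → H _ pp p∣x) (all-filter prime-factor? (upTo (suc x)))))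

open Radical

cosocle*rad≤ : ∀ m → cosocle m * rad m ≤ m
cosocle*rad≤ m = subst (λ r → cosocle m * r ≤ m) (suc-pred (rad m) {{>-nonZero (rad≥1 m)}})
  (m/n*n≤m m (suc (pred (rad m))))

abc-triple-of-≡1[mod] : ∀ {n m X} → 0 < n → 1 < X → X ≡1[mod m ] → cosocle m > rad n →
                        (∀ p → Prime p → p ∣ X → p ∣ n) → IsAbcTriple 1 (X ∸ 1) X
abc-triple-of-≡1[mod] {n} {m} 0<n (s≤s 0<m*t) (t , refl) rad<cosocle X∣⇒n∣ =
  (s≤s z≤n , 0<m*t , s≤s z≤n) ,
  (1-coprimeTo _ , 1-coprimeTo _ , λ (g∣m*t , g∣X) → ∣1⇒≡1 (∣1+m⇒∣m⇒∣1 g∣X g∣m*t)) ,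
  refl ,
  s≤s (≤-trans (rad≤ _ {{>-nonZero 0<bound}} prime∣bound) (*-monoˡ-≤ t rad[n]*rad[m]≤m))
  where
  instance
    m≢0 : NonZero m
    m≢0 = m*n≢0⇒m≢0 m {{>-nonZero 0<m*t}}
    t≢0 : NonZero t
    t≢0 = m*n≢0⇒n≢0 m {{>-nonZero 0<m*t}}
    n≢0 : NonZero n
    n≢0 = >-nonZero 0<n
  0<bound : 0 < rad n * rad m * t
  0<bound = *-mono-≤ (*-mono-≤ (rad≥1 n) (rad≥1 m)) (>-nonZero⁻¹ t)
  rad[n]*rad[m]≤m : rad n * rad m ≤ m
  rad[n]*rad[m]≤m = ≤-trans (*-monoˡ-≤ (rad m) (<⇒≤ rad<cosocle)) (cosocle*rad≤ m)
  prime∣bound : ∀ p → Prime p → p ∣ 1 * (m * t) * (1 + m * t) → p ∣ rad n * rad m * t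
  prime∣bound p pp p∣abc with euclidsLemma (1 * (m * t)) (1 + m * t) pp p∣abc
  ... | inj₂ p∣X = ∣m⇒∣m*n t (∣m⇒∣m*n (rad m) (prime∣⇒∣rad n pp (X∣⇒n∣ p pp p∣X)))
  ... | inj₁ p∣m*t with euclidsLemma m t pp (subst (p ∣_) (*-identityˡ (m * t)) p∣m*t)
  ...   | inj₁ p∣m = ∣m⇒∣m*n t (∣n⇒∣m*n (rad n) (prime∣⇒∣rad m pp p∣m))
  ...   | inj₂ p∣t = ∣n⇒∣m*n (rad n * rad m) p∣t

div2^-2^* : ∀ e y → div2^ (2 ^ e * y) e ≡ y
div2^-2^* e y = cancel (2 ^ e) {{m^n≢0 2 e}}
  where
  cancel : ∀ P .{{_ : NonZero P}} → P * y / suc (pred P) ≡ y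
  cancel (suc P) = trans (cong (_/ suc P) (*-comm (suc P) y)) (m*n/n≡m y (suc P))

div2^-square : ∀ {a o x} y → x ≡ 2 ^ a * o → div2^ (y * x ^ 2) (2 * a) ≡ y * (o * o)
div2^-square {a} {o} y refl = trans (cong (λ z → div2^ z (2 * a)) regroup) (div2^-2^* (2 * a) (y * (o * o)))
  where
  regroup : y * (2 ^ a * o) ^ 2 ≡ 2 ^ (2 * a) * (y * (o * o))
  regroup = begin
    y * (2 ^ a * o) ^ 2                ≡⟨ square-of-product y (2 ^ a) o ⟩
    2 ^ a * 2 ^ a * (y * (o * o))      ≡⟨ cong (λ e → 2 ^ a * 2 ^ e * (y * (o * o))) (sym (+-identityʳ a)) ⟩
    2 ^ a * 2 ^ (a + 0) * (y * (o * o)) ≡⟨ cong (_* (y * (o * o))) (sym (^-distribˡ-+-* 2 a (a + 0))) ⟩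
    2 ^ (2 * a) * (y * (o * o))        ∎
    where
    square-of-product : ∀ y P o → y * ((P * o) * ((P * o) * 1)) ≡ P * P * (y * (o * o))
    square-of-product = solve-∀

1<x⇒1<x^e : ∀ {x} e → 1 < x → 0 < e → 1 < x ^ e
1<x⇒1<x^e {x} (suc e) 1<x _ =
  <-≤-trans 1<x (m≤m*n x (x ^ e) {{m^n≢0 x e {{>-nonZero (<-trans (s≤s z≤n) 1<x)}}}})

0<gcd : ∀ m {n} → 0 < n → 0 < gcd m n
0<gcd m {n} 0<n = n≢0⇒n>0 (gcd[m,n]≢0 m n (inj₂ (n>0⇒n≢0 0<n)))

abc-triple-of-odd-power : ∀ {n} c → Odd n → 1 < n → 0 < c →
  cosocle (div2^ (2 ^ v₂ (4 * (2 * c)) * gcd (n ∸ 1) (2 * c) ^ 2) (2 * v₂ (gcd (n ∸ 1) (2 * c)))) > rad n →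
  ∀ k → 0 < k → IsAbcTriple 1 (n ^ (2 * c * k) ∸ 1) (n ^ (2 * c * k))
abc-triple-of-odd-power zero _ _ () _ _ _
abc-triple-of-odd-power {n} c@(suc _) odd-n 1<n 0<c cosocle>rad k 0<k
  with v₂-decomposition (0<gcd (n ∸ 1) {2 * c} (s≤s z≤n))
... | o , odd-o , d≡ =
  abc-triple-of-≡1[mod] 0<n (1<x⇒1<x^e (2 * c * k) 1<n (*-mono-≤ {1} {2 * c} (s≤s z≤n) 0<k))
    (≡1[mod]-* (2^-coprime-odd² (3 + v₂ c) odd-o) two-part odd-part)
    (subst (λ m → cosocle m > rad n) m≡ cosocle>rad)
    (λ p pp → prime∣^⇒∣ n (2 * c * k) pp)
  where
  0<n : 0 < n
  0<n = <-trans (s≤s z≤n) 1<n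
  d : ℕ
  d = gcd (n ∸ 1) (2 * c)
  m≡ : div2^ (2 ^ v₂ (4 * (2 * c)) * d ^ 2) (2 * v₂ d) ≡ 2 ^ (3 + v₂ c) * (o * o)
  m≡ = begin
    div2^ (2 ^ v₂ (4 * (2 * c)) * d ^ 2) (2 * v₂ d) ≡⟨ div2^-square {v₂ d} (2 ^ v₂ (4 * (2 * c))) d≡ ⟩
    2 ^ v₂ (4 * (2 * c)) * (o * o)                  ≡⟨ cong (λ x → 2 ^ v₂ x * (o * o)) (sym (*-assoc 4 2 c)) ⟩
    2 ^ v₂ (2 ^ 3 * c) * (o * o)                    ≡⟨ cong (λ v → 2 ^ v * (o * o)) (v₂-2^* 3 0<c) ⟩
    2 ^ (3 + v₂ c) * (o * o)                        ∎
  two-part : n ^ (2 * c * k) ≡1[mod 2 ^ (3 + v₂ c) ]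
  two-part = subst (_≡1[mod 2 ^ (3 + v₂ c) ]) (^-*-assoc n (2 * c) k)
    (≡1[mod]-^ (odd^[2e]≡1[mod2^[3+v₂e]] odd-n 0<c) k)
  odd-part : n ^ (2 * c * k) ≡1[mod o * o ]
  odd-part = ≡1[mod]-∣ (*-pres-∣ o∣d o∣d) (≡1[mod]-^-multiple
    (∣∸1⇒≡1[mod] 0<n (gcd[m,n]∣m (n ∸ 1) (2 * c))) (∣m⇒∣m*n k (gcd[m,n]∣n (n ∸ 1) (2 * c))))
    where
    o∣d : o ∣ d
    o∣d = divides (2 ^ v₂ d) d≡

corollary3p2 : (n : ℕ) → 1 < n → (∃ λ j → n ≡ 2 * j + 1) →
    cosocle (div2^ (2 ^ v₂ (4 * φ n) * gcd (n ∸ 1) (φ n) ^ 2) (2 * v₂ (gcd (n ∸ 1) (φ n)))) > rad n →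
    (k : ℕ) → 0 < k →
    IsAbcTriple 1 (n ^ (φ n * k) ∸ 1) (n ^ (φ n * k))
corollary3p2 n 1<n (j , n≡2j+1) cosocle>rad k 0<k
  with φ n | φ-odd-even (j , trans n≡2j+1 (+-comm (2 * j) 1)) 1<n
... | _ | c , 0<c , refl = abc-triple-of-odd-power c (j , trans n≡2j+1 (+-comm (2 * j) 1)) 1<n 0<c cosocle>rad k 0<k
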